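{- Let $1\leq t\leq k-2$ and $2k\leq n$, let $\mathcal{F}\subseteq\binom{[n]}{k}$ be a maximal $t$-intersecting family with $\tau_t(\mathcal{F})=t+1$, let $\mathcal{T}=\{T\in\binom{[n]}{t+1}: |T\cap F|\geq t \text{ for all } F\in\mathcal{F}\}$, and set $M=\bigcup_{T\in\mathcal{T}}T$. Suppose that $\tau_t(\mathcal{T})=t$, $|M|=k+1$, and $X$ is a $t$-subset of $[n]$ contained in every $T\in\mathcal{T}$. Then $$\mathcal{F}=\left\{F\in\binom{[n]}{k}: X\subseteq F,\ |F\cap M|\geq t+1\right\}\cup\binom{M}{k}.$$
   Context: $\binom{[n]}{k}$ denotes the family of $k$-subsets of $[n]=\{1,\ldots,n\}$. A family $\mathcal{G}$ of sets is $t$-intersecting if $|A\cap B|\geq t$ for all $A,B\in\mathcal{G}$. "Maximal" means maximal under inclusion among $t$-intersecting subfamilies of $\binom{[n]}{k}$. The $t$-covering number $\tau_t(\mathcal{G})$ of a family $\mathcal{G}$ of subsets of $[n]$ is the minimum size of a subset $T\subseteq[n]$ with $|T\cap G|\geq t$ for all $G\in\mathcal{G}$. -}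

module Defs where

open import Level using (0ℓ)
open import Data.Nat using (ℕ; suc; _≤_)
open import Data.Fin using (Fin)
open import Data.Fin.Subset using (Subset; _∈_; _⊆_; _∩_; ∣_∣)
open import Data.Product using (_×_; Σ; ∃)
open import Relation.Unary using (Pred)
open import Relation.Binary.PropositionalEquality using (_≡_)

Family : ℕ → Set₁
Family n = Pred (Subset n) 0ℓ

IsKUniform : ∀ {n} → ℕ → Family n → Set
IsKUniform k 𝒢 = ∀ A → 𝒢 A → ∣ A ∣ ≡ k

_⊑_ : ∀ {n} → Family n → Family n → Set
𝒢 ⊑ ℋ = ∀ A → 𝒢 A → ℋ A

IsTIntersecting : ∀ {n} → ℕ → Family n → Set
IsTIntersecting t 𝒢 = ∀ A B → 𝒢 A → 𝒢 B → t ≤ ∣ A ∩ B ∣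

IsMaximalTIntersecting : ∀ {n} → ℕ → ℕ → Family n → Set₁
IsMaximalTIntersecting k t ℱ =
  IsKUniform k ℱ × IsTIntersecting t ℱ ×
  (∀ (𝒢 : Family _) → IsKUniform k 𝒢 → IsTIntersecting t 𝒢 → ℱ ⊑ 𝒢 → 𝒢 ⊑ ℱ)

IsTCover : ∀ {n} → ℕ → Family n → Subset n → Set
IsTCover t 𝒢 T = ∀ G → 𝒢 G → t ≤ ∣ T ∩ G ∣

TCoverNumberIs : ∀ {n} → ℕ → Family n → ℕ → Set
TCoverNumberIs t 𝒢 m =
  (Σ _ λ T → IsTCover t 𝒢 T × ∣ T ∣ ≡ m) × (∀ T → IsTCover t 𝒢 T → m ≤ ∣ T ∣)

CoverFamily : ∀ {n} → ℕ → Family n → Family n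
CoverFamily t ℱ T = ∣ T ∣ ≡ suc t × IsTCover t ℱ T

module Submission where

-- Every
-- T ∈ 𝒯 contains the t-set X, so T = X ∪ {i} for a single point i, and M is
-- X together with k + 1 - t further points.  Call F ∈ ℱ deficient when
-- |X ∩ F| < t.  A deficient F must contain every point i ∈ M ─ X (otherwise
-- T = X ∪ {i} meets F in fewer than t points), and |X ∩ F| = t - 1 because a
-- cover T₀ ∈ 𝒯 adds only one point to X; counting gives |F ∩ M| ≥ k, so F ⊆ M.
-- A non-deficient F contains X, and then |F ∩ M| ≥ t + 1: otherwise F ∩ M = X
-- and X would be a t-cover of ℱ of size t, contradicting τ_t(ℱ) = t + 1.
-- Hence ℱ is contained in the family ℋ on the right-hand side.  Conversely ℋ
-- is k-uniform and t-intersecting, so maximality of ℱ gives ℋ ⊆ ℱ.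

open import Defs
open import Data.Nat using (ℕ; suc; _≤_; _+_; _*_)
open import Data.Fin using (Fin)
open import Data.Fin.Subset using (Subset; _∈_; _⊆_; _∩_; ∣_∣)
open import Data.Product using (_×_; Σ)
open import Data.Sum using (_⊎_)
open import Function.Bundles using (_⇔_)
open import Relation.Binary.PropositionalEquality using (_≡_)

open import Data.Nat using (_<_; _≤?_)
open import Data.Nat.Properties
open import Data.Bool using (true; false)
open import Data.Vec using ([]; _∷_)
open import Data.Fin.Subset using (∁; _∉_)
open import Data.Fin.Subset.Properties
  using (p⊆q⇒∣p∣≤∣q∣; p⊂q⇒∣p∣<∣q∣; _∈?_; x∈p∩q⁺; x∈p∩q⁻; p∩q⊆p; ∣p∩q∣≤∣q∣; ∩-comm;
         x∉p⇒x∈∁p; x∈∁p⇒x∉p)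
open import Data.Product using (_,_; proj₁; proj₂)
open import Data.Sum using (inj₁; inj₂)
open import Relation.Nullary using (¬_; yes; no; contradiction)
open import Relation.Binary.PropositionalEquality using (refl; sym; trans; cong; subst)
open import Function.Bundles using (Equivalence; mk⇔)

∣∩∣+∣∩∁∣≡∣∣ : ∀ {n} (A B : Subset n) → ∣ A ∩ B ∣ + ∣ A ∩ ∁ B ∣ ≡ ∣ A ∣
∣∩∣+∣∩∁∣≡∣∣ [] [] = refl
∣∩∣+∣∩∁∣≡∣∣ (false ∷ A) (_ ∷ B) = ∣∩∣+∣∩∁∣≡∣∣ A B
∣∩∣+∣∩∁∣≡∣∣ (true ∷ A) (true ∷ B) = cong suc (∣∩∣+∣∩∁∣≡∣∣ A B)
∣∩∣+∣∩∁∣≡∣∣ (true ∷ A) (false ∷ B) = trans (+-suc _ _) (cong suc (∣∩∣+∣∩∁∣≡∣∣ A B))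

module _ {n : ℕ} where

  ∩-mono-⊆ : ∀ {A A′ B B′ : Subset n} → A ⊆ A′ → B ⊆ B′ → A ∩ B ⊆ A′ ∩ B′
  ∩-mono-⊆ {A} {B = B} A⊆A′ B⊆B′ x∈A∩B with x∈p∩q⁻ A B x∈A∩B
  ... | x∈A , x∈B = x∈p∩q⁺ (A⊆A′ x∈A , B⊆B′ x∈B)

  ∣∩∣-comm : ∀ (A B : Subset n) → ∣ A ∩ B ∣ ≡ ∣ B ∩ A ∣
  ∣∩∣-comm A B = cong ∣_∣ (∩-comm A B)

  ⊆∧∣∣≥⇒⊇ : ∀ {A B : Subset n} → A ⊆ B → ∣ B ∣ ≤ ∣ A ∣ → B ⊆ A
  ⊆∧∣∣≥⇒⊇ {A} A⊆B ∣B∣≤∣A∣ {x} x∈B with x ∈? A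
  ... | yes x∈A = x∈A
  ... | no x∉A = contradiction ∣B∣≤∣A∣ (<⇒≱ (p⊂q⇒∣p∣<∣q∣ (A⊆B , x , x∈B , x∉A)))

  ∣∣≤∣∩∣⇒⊆ : ∀ {X A : Subset n} → ∣ X ∣ ≤ ∣ X ∩ A ∣ → X ⊆ A
  ∣∣≤∣∩∣⇒⊆ {X} {A} le x∈X = proj₂ (x∈p∩q⁻ X A (⊆∧∣∣≥⇒⊇ (p∩q⊆p X A) le x∈X))

  ⊆⇒∣∩∣≡∣∣ : ∀ {B M : Subset n} → B ⊆ M → ∣ M ∩ B ∣ ≡ ∣ B ∣
  ⊆⇒∣∩∣≡∣∣ {B} {M} B⊆M =
    ≤-antisym (∣p∩q∣≤∣q∣ M B) (p⊆q⇒∣p∣≤∣q∣ (λ x∈B → x∈p∩q⁺ (B⊆M x∈B , x∈B)))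

  ⊆⇒∣∣+∣∩∁∣≡∣∣ : ∀ {B M : Subset n} → B ⊆ M → ∣ B ∣ + ∣ M ∩ ∁ B ∣ ≡ ∣ M ∣
  ⊆⇒∣∣+∣∩∁∣≡∣∣ {B} {M} B⊆M =
    trans (cong (_+ ∣ M ∩ ∁ B ∣) (sym (⊆⇒∣∩∣≡∣∣ B⊆M))) (∣∩∣+∣∩∁∣≡∣∣ M B)

  ∣∩∣≤∣∩∣+∣∩∁∣ : ∀ (B M A : Subset n) → ∣ M ∩ A ∣ ≤ ∣ B ∩ A ∣ + ∣ (M ∩ A) ∩ ∁ B ∣
  ∣∩∣≤∣∩∣+∣∩∁∣ B M A = begin
    ∣ M ∩ A ∣                             ≡⟨ sym (∣∩∣+∣∩∁∣≡∣∣ (M ∩ A) B) ⟩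
    ∣ (M ∩ A) ∩ B ∣ + ∣ (M ∩ A) ∩ ∁ B ∣   ≤⟨ +-monoˡ-≤ _ (p⊆q⇒∣p∣≤∣q∣ inB) ⟩
    ∣ B ∩ A ∣ + ∣ (M ∩ A) ∩ ∁ B ∣         ∎
    where
    open ≤-Reasoning
    inB : (M ∩ A) ∩ B ⊆ B ∩ A
    inB x∈ with x∈p∩q⁻ (M ∩ A) B x∈
    ... | x∈M∩A , x∈B = x∈p∩q⁺ (x∈B , proj₂ (x∈p∩q⁻ M A x∈M∩A))

  ∩∁⊆∁ : ∀ (B M A : Subset n) → (M ∩ A) ∩ ∁ B ⊆ M ∩ ∁ B
  ∩∁⊆∁ B M A = ∩-mono-⊆ (p∩q⊆p M A) (λ x∈∁B → x∈∁B)

  module OnePointExtension {B M : Subset n} (B⊆M : B ⊆ M) (∣M∣≡ : ∣ M ∣ ≡ suc ∣ B ∣) where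

    ∣M─B∣≡1 : ∣ M ∩ ∁ B ∣ ≡ 1
    ∣M─B∣≡1 = +-cancelˡ-≡ ∣ B ∣ _ _ (trans (⊆⇒∣∣+∣∩∁∣≡∣∣ B⊆M) (trans ∣M∣≡ (+-comm 1 ∣ B ∣)))

    ∣M∩A∣≤1+∣B∩A∣ : ∀ A → ∣ M ∩ A ∣ ≤ suc ∣ B ∩ A ∣
    ∣M∩A∣≤1+∣B∩A∣ A = begin
      ∣ M ∩ A ∣                        ≤⟨ ∣∩∣≤∣∩∣+∣∩∁∣ B M A ⟩
      ∣ B ∩ A ∣ + ∣ (M ∩ A) ∩ ∁ B ∣    ≤⟨ +-monoʳ-≤ ∣ B ∩ A ∣ (p⊆q⇒∣p∣≤∣q∣ (∩∁⊆∁ B M A)) ⟩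
      ∣ B ∩ A ∣ + ∣ M ∩ ∁ B ∣          ≡⟨ cong (∣ B ∩ A ∣ +_) ∣M─B∣≡1 ⟩
      ∣ B ∩ A ∣ + 1                    ≡⟨ +-comm ∣ B ∩ A ∣ 1 ⟩
      suc ∣ B ∩ A ∣                    ∎
      where open ≤-Reasoning

    ∣M∩A∣≤∣B∩A∣ : ∀ {A y} → y ∈ M → y ∉ B → y ∉ A → ∣ M ∩ A ∣ ≤ ∣ B ∩ A ∣
    ∣M∩A∣≤∣B∩A∣ {A} {y} y∈M y∉B y∉A = begin
      ∣ M ∩ A ∣                        ≤⟨ ∣∩∣≤∣∩∣+∣∩∁∣ B M A ⟩
      ∣ B ∩ A ∣ + ∣ (M ∩ A) ∩ ∁ B ∣    ≡⟨ cong (∣ B ∩ A ∣ +_) outside-empty ⟩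
      ∣ B ∩ A ∣ + 0                    ≡⟨ +-identityʳ _ ⟩
      ∣ B ∩ A ∣                        ∎
      where
      open ≤-Reasoning
      y∉outside : y ∉ (M ∩ A) ∩ ∁ B
      y∉outside y∈ = y∉A (proj₂ (x∈p∩q⁻ M A (proj₁ (x∈p∩q⁻ (M ∩ A) (∁ B) y∈))))
      -- the outside part is a proper subset of the one-point set M ─ B
      outside-empty : ∣ (M ∩ A) ∩ ∁ B ∣ ≡ 0
      outside-empty = n<1⇒n≡0 (subst (∣ (M ∩ A) ∩ ∁ B ∣ <_) ∣M─B∣≡1
        (p⊂q⇒∣p∣<∣q∣ (∩∁⊆∁ B M A , y , x∈p∩q⁺ (y∈M , x∉p⇒x∈∁p y∉B) , y∉outside)))

module MaximalFamily {n k t : ℕ} (t+2≤k : t + 2 ≤ k)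
    (ℱ : Family n) (ℱ-max : IsMaximalTIntersecting k t ℱ)
    (τℱ : TCoverNumberIs t ℱ (suc t))
    (M : Subset n) (M-def : ∀ (i : Fin n) → i ∈ M ⇔ Σ (Subset n) (λ T → CoverFamily t ℱ T × i ∈ T))
    (∣M∣≡ : ∣ M ∣ ≡ suc k)
    (X : Subset n) (∣X∣≡t : ∣ X ∣ ≡ t) (X⊆𝒯 : ∀ T → CoverFamily t ℱ T → X ⊆ T) where

  ℱ-uniform : IsKUniform k ℱ
  ℱ-uniform = proj₁ ℱ-max

  ℱ-intersecting : IsTIntersecting t ℱ
  ℱ-intersecting = proj₁ (proj₂ ℱ-max)

  𝒯-extends-X : ∀ T → CoverFamily t ℱ T → ∣ T ∣ ≡ suc ∣ X ∣
  𝒯-extends-X _ (∣T∣≡ , _) = trans ∣T∣≡ (cong suc (sym ∣X∣≡t))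

  -- A minimum t-cover of ℱ has size t + 1, hence belongs to 𝒯.
  T₀ : Subset n
  T₀ = proj₁ (proj₁ τℱ)

  T₀∈𝒯 : CoverFamily t ℱ T₀
  T₀∈𝒯 = proj₂ (proj₂ (proj₁ τℱ)) , proj₁ (proj₂ (proj₁ τℱ))

  X⊆M : X ⊆ M
  X⊆M x∈X = Equivalence.from (M-def _) (T₀ , T₀∈𝒯 , X⊆𝒯 T₀ T₀∈𝒯 x∈X)

  deficient⇒⊇M─X : ∀ {F} → ℱ F → ∣ X ∩ F ∣ < t → ∀ {i} → i ∈ M → i ∉ X → i ∈ F
  deficient⇒⊇M─X {F} F∈ℱ deficient {i} i∈M i∉X with i ∈? F
  ... | yes i∈F = i∈F
  ... | no i∉F with Equivalence.to (M-def i) i∈M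
  ... | T , T∈𝒯 , i∈T = contradiction (≤-trans (proj₂ T∈𝒯 F F∈ℱ) T∩F≤X∩F) (<⇒≱ deficient)
    where
    open OnePointExtension (X⊆𝒯 T T∈𝒯) (𝒯-extends-X T T∈𝒯)
    T∩F≤X∩F : ∣ T ∩ F ∣ ≤ ∣ X ∩ F ∣
    T∩F≤X∩F = ∣M∩A∣≤∣B∩A∣ i∈T i∉X i∉F

  -- A deficient member lies inside M: it has t - 1 points in X and all
  -- k + 1 - t points of M ─ X, i.e. k points of M.
  deficient⇒⊆M : ∀ {F} → ℱ F → ∣ X ∩ F ∣ < t → F ⊆ M
  deficient⇒⊆M {F} F∈ℱ deficient = λ x∈F → proj₂ (x∈p∩q⁻ F M (F⊆F∩M x∈F))
    where
    open OnePointExtension (X⊆𝒯 T₀ T₀∈𝒯) (𝒯-extends-X T₀ T₀∈𝒯)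
    1+∣X∩F∣≡t : suc ∣ X ∩ F ∣ ≡ t
    1+∣X∩F∣≡t = ≤-antisym deficient (≤-trans (proj₂ T₀∈𝒯 F F∈ℱ) (∣M∩A∣≤1+∣B∩A∣ F))
    ∣X∩F∣+∣M─X∣≡k : ∣ X ∩ F ∣ + ∣ M ∩ ∁ X ∣ ≡ k
    ∣X∩F∣+∣M─X∣≡k = suc-injective (begin-equality
      suc ∣ X ∩ F ∣ + ∣ M ∩ ∁ X ∣  ≡⟨ cong (_+ ∣ M ∩ ∁ X ∣) (trans 1+∣X∩F∣≡t (sym ∣X∣≡t)) ⟩
      ∣ X ∣ + ∣ M ∩ ∁ X ∣          ≡⟨ ⊆⇒∣∣+∣∩∁∣≡∣∣ X⊆M ⟩
      ∣ M ∣                        ≡⟨ ∣M∣≡ ⟩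
      suc k                        ∎)
      where open ≤-Reasoning
    inX : X ∩ F ⊆ (F ∩ M) ∩ X
    inX x∈ with x∈p∩q⁻ X F x∈
    ... | x∈X , x∈F = x∈p∩q⁺ (x∈p∩q⁺ (x∈F , X⊆M x∈X) , x∈X)
    outX : M ∩ ∁ X ⊆ (F ∩ M) ∩ ∁ X
    outX x∈ with x∈p∩q⁻ M (∁ X) x∈
    ... | x∈M , x∈∁X =
      x∈p∩q⁺ (x∈p∩q⁺ (deficient⇒⊇M─X F∈ℱ deficient x∈M (x∈∁p⇒x∉p x∈∁X) , x∈M) , x∈∁X)
    F⊆F∩M : F ⊆ F ∩ M
    F⊆F∩M = ⊆∧∣∣≥⇒⊇ (p∩q⊆p F M) (begin
      ∣ F ∣                                ≡⟨ ℱ-uniform F F∈ℱ ⟩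
      k                                    ≡⟨ sym ∣X∩F∣+∣M─X∣≡k ⟩
      ∣ X ∩ F ∣ + ∣ M ∩ ∁ X ∣              ≤⟨ +-mono-≤ (p⊆q⇒∣p∣≤∣q∣ inX) (p⊆q⇒∣p∣≤∣q∣ outX) ⟩
      ∣ (F ∩ M) ∩ X ∣ + ∣ (F ∩ M) ∩ ∁ X ∣  ≡⟨ ∣∩∣+∣∩∁∣≡∣∣ (F ∩ M) X ⟩
      ∣ F ∩ M ∣                            ∎)
      where open ≤-Reasoning

  -- If some member meets M only inside X, then X is a t-cover of ℱ: a deficient
  -- member G lies in M, so it meets A only inside X.
  trace⊆X⇒X-covers : ∀ {A} → ℱ A → A ∩ M ⊆ X → IsTCover t ℱ X
  trace⊆X⇒X-covers {A} A∈ℱ A∩M⊆X G G∈ℱ with t ≤? ∣ X ∩ G ∣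
  ... | yes covered = covered
  ... | no ¬covered = ≤-trans (ℱ-intersecting A G A∈ℱ G∈ℱ) (p⊆q⇒∣p∣≤∣q∣ A∩G⊆X∩G)
    where
    G⊆M : G ⊆ M
    G⊆M = deficient⇒⊆M G∈ℱ (≰⇒> ¬covered)
    A∩G⊆X∩G : A ∩ G ⊆ X ∩ G
    A∩G⊆X∩G x∈ with x∈p∩q⁻ A G x∈
    ... | x∈A , x∈G = x∈p∩q⁺ (A∩M⊆X (x∈p∩q⁺ (x∈A , G⊆M x∈G)) , x∈G)

  X⊆F⇒t<∣F∩M∣ : ∀ {F} → ℱ F → X ⊆ F → suc t ≤ ∣ F ∩ M ∣
  X⊆F⇒t<∣F∩M∣ {F} F∈ℱ X⊆F with suc t ≤? ∣ F ∩ M ∣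
  ... | yes large = large
  ... | no ¬large = contradiction (proj₂ τℱ X (trace⊆X⇒X-covers F∈ℱ F∩M⊆X)) t+1≰∣X∣
    where
    t+1≰∣X∣ : ¬ suc t ≤ ∣ X ∣
    t+1≰∣X∣ = subst (λ s → ¬ suc t ≤ s) (sym ∣X∣≡t) (<-irrefl refl)
    F∩M⊆X : F ∩ M ⊆ X
    F∩M⊆X = ⊆∧∣∣≥⇒⊇ (λ x∈X → x∈p∩q⁺ (X⊆F x∈X , X⊆M x∈X))
              (subst (∣ F ∩ M ∣ ≤_) (sym ∣X∣≡t) (≤-pred (≰⇒> ¬large)))

  ℋ : Family n
  ℋ A = (∣ A ∣ ≡ k × X ⊆ A × suc t ≤ ∣ A ∩ M ∣) ⊎ (∣ A ∣ ≡ k × A ⊆ M)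

  ℱ⊑ℋ : ℱ ⊑ ℋ
  ℱ⊑ℋ F F∈ℱ with t ≤? ∣ X ∩ F ∣
  ... | no ¬full = inj₂ (ℱ-uniform F F∈ℱ , deficient⇒⊆M F∈ℱ (≰⇒> ¬full))
  ... | yes full = inj₁ (ℱ-uniform F F∈ℱ , X⊆F , X⊆F⇒t<∣F∩M∣ F∈ℱ X⊆F)
    where
    X⊆F : X ⊆ F
    X⊆F = ∣∣≤∣∩∣⇒⊆ (subst (_≤ ∣ X ∩ F ∣) (sym ∣X∣≡t) full)

  ℋ-uniform : IsKUniform k ℋ
  ℋ-uniform A (inj₁ (∣A∣≡k , _)) = ∣A∣≡k
  ℋ-uniform A (inj₂ (∣A∣≡k , _)) = ∣A∣≡k

  -- A k-subset B of M misses only one point of M, so it meets every A with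
  -- |A ∩ M| ≥ t + 1 in at least t points.
  ⊆M-meets-large : ∀ {A B} → suc t ≤ ∣ A ∩ M ∣ → ∣ B ∣ ≡ k → B ⊆ M → t ≤ ∣ B ∩ A ∣
  ⊆M-meets-large {A} {B} large ∣B∣≡k B⊆M = ≤-pred (begin
    suc t          ≤⟨ large ⟩
    ∣ A ∩ M ∣      ≡⟨ ∣∩∣-comm A M ⟩
    ∣ M ∩ A ∣      ≤⟨ ∣M∩A∣≤1+∣B∩A∣ A ⟩
    suc ∣ B ∩ A ∣  ∎)
    where
    open ≤-Reasoning
    open OnePointExtension B⊆M (trans ∣M∣≡ (cong suc (sym ∣B∣≡k)))

  -- Two k-subsets of the (k+1)-set M share k - 1 ≥ t points.
  ⊆M-meet : ∀ {A B} → ∣ A ∣ ≡ k → A ⊆ M → ∣ B ∣ ≡ k → B ⊆ M → t ≤ ∣ B ∩ A ∣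
  ⊆M-meet {A} {B} ∣A∣≡k A⊆M ∣B∣≡k B⊆M =
    ⊆M-meets-large (≤-trans t+1<k (≤-reflexive (sym ∣A∩M∣≡k))) ∣B∣≡k B⊆M
    where
    t+1<k : suc t ≤ k
    t+1<k = ≤-trans (n≤1+n (suc t)) (subst (_≤ k) (+-comm t 2) t+2≤k)
    ∣A∩M∣≡k : ∣ A ∩ M ∣ ≡ k
    ∣A∩M∣≡k = trans (∣∩∣-comm A M) (trans (⊆⇒∣∩∣≡∣∣ A⊆M) ∣A∣≡k)

  ℋ-intersecting : IsTIntersecting t ℋ
  ℋ-intersecting A B (inj₁ (_ , X⊆A , _)) (inj₁ (_ , X⊆B , _)) =
    subst (_≤ ∣ A ∩ B ∣) ∣X∣≡t (p⊆q⇒∣p∣≤∣q∣ (λ x∈X → x∈p∩q⁺ (X⊆A x∈X , X⊆B x∈X)))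
  ℋ-intersecting A B (inj₁ (_ , _ , large)) (inj₂ (∣B∣≡k , B⊆M)) =
    subst (t ≤_) (∣∩∣-comm B A) (⊆M-meets-large large ∣B∣≡k B⊆M)
  ℋ-intersecting A B (inj₂ (∣A∣≡k , A⊆M)) (inj₁ (_ , _ , large)) =
    ⊆M-meets-large large ∣A∣≡k A⊆M
  ℋ-intersecting A B (inj₂ (∣A∣≡k , A⊆M)) (inj₂ (∣B∣≡k , B⊆M)) =
    ⊆M-meet ∣B∣≡k B⊆M ∣A∣≡k A⊆M

  ℱ⇔ℋ : ∀ A → ℱ A ⇔ ℋ A
  ℱ⇔ℋ A = mk⇔ (ℱ⊑ℋ A) (proj₂ (proj₂ ℱ-max) ℋ ℋ-uniform ℋ-intersecting ℱ⊑ℋ A)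

lemma2p3 : (n k t : ℕ) → 1 ≤ t → t + 2 ≤ k → 2 * k ≤ n →
    (ℱ : Family n) → IsMaximalTIntersecting k t ℱ →
    TCoverNumberIs t ℱ (suc t) →
    (M : Subset n) → (∀ (i : Fin n) → i ∈ M ⇔ Σ (Subset n) (λ T → CoverFamily t ℱ T × i ∈ T)) →
    TCoverNumberIs t (CoverFamily t ℱ) t →
    ∣ M ∣ ≡ suc k →
    (X : Subset n) → ∣ X ∣ ≡ t → (∀ T → CoverFamily t ℱ T → X ⊆ T) →
    ∀ (A : Subset n) →
      ℱ A ⇔ ((∣ A ∣ ≡ k × X ⊆ A × suc t ≤ ∣ A ∩ M ∣) ⊎ (∣ A ∣ ≡ k × A ⊆ M))
lemma2p3 n k t _ t+2≤k _ ℱ ℱ-max τℱ M M-def _ ∣M∣≡ X ∣X∣≡t X⊆𝒯 =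
  MaximalFamily.ℱ⇔ℋ t+2≤k ℱ ℱ-max τℱ M M-def ∣M∣≡ X ∣X∣≡t X⊆𝒯
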